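{- For $k = 3$, the translation $\tau$ with $\tau(!) = P_1T_3P_2T_1$ and $\tau(?) = P_3T_2$ is correct for initial store $(\Box,\blacksquare,\blacksquare)$.
   Context: SYNCSIMPLE: subprocesses $U ::= \checkmark \mid 0 \mid\ !U \mid\ ?U$; processes are parallel compositions $U_1 \mid \ldots \mid U_n$ (parallel composition is associative and commutative with $0$ as identity, so a process is a multiset of subprocesses). Reduction: $!U_1 \mid ?U_2 \mid P \to U_1 \mid U_2 \mid P$. A process is successful if it has the form $\checkmark \mid P$. It is may-convergent if it reduces (in zero or more steps) to a successful process, must-convergent if every process it reduces to is may-convergent. LOCKSIMPLE$_{k,IS}$: $k$ locks $C_1,\dots,C_k$, each full ($\blacksquare$) or empty ($\Box$), with initial store $IS\in\{\Box,\blacksquare\}^k$. Subprocesses $U ::= 0 \mid \checkmark \mid P_iU \mid T_iU$ ($1\le i\le k$), processes are parallel compositions of subprocesses. Reduction acts on states (process, store): $(P_iU \mid P, C[C_i=\Box]) \to (U \mid P, C[C_i\mapsto\blacksquare])$ (so $P_i$ blocks while $C_i$ is full), and $(T_iU\mid P, C)\to (U\mid P, C[C_i\mapsto \Box])$ ($T_i$ never blocks). A process is successful if it contains $\checkmark$ as a parallel component; a process $P$ is may-/must-convergent if the state $(P,IS)$ is, with the same definitions as in SYNCSIMPLE. A translation $\tau$ from SYNCSIMPLE-processes to LOCKSIMPLE$_{k,IS}$-processes is compositional if $\tau(0)=0$, $\tau(\checkmark)=\checkmark$, $\tau(P_1\mid P_2)=\tau(P_1)\mid\tau(P_2)$, $\tau(U)$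 contains no parallel operator for a subprocess $U$, and $\tau(!U)=\tau(!)\tau(U)$, $\tau(?U)=\tau(?)\tau(U)$; it is thus given by the pair of strings $(\tau(!),\tau(?))$. It is correct if for every SYNCSIMPLE-process $P$: $P$ is may-convergent iff $\tau(P)$ is, and $P$ is must-convergent iff $\tau(P)$ is. -}

module Defs where

open import Data.Nat using (ℕ)
open import Data.Fin using (Fin; zero; suc)
open import Data.Bool using (Bool; true; false)
open import Data.Vec using (Vec; []; _∷_; lookup; _[_]≔_)
open import Data.List using (List; []; _∷_; map)
open import Data.List.Relation.Unary.Any using (Any)
open import Data.List.Relation.Binary.Permutation.Propositional using (_↭_)
open import Data.Product using (_×_; ∃; ∃-syntax; _,_)
open import Relation.Binary.PropositionalEquality using (_≡_)
open import Relation.Binary.Construct.Closure.ReflexiveTransitive using (Star)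
open import Function.Bundles using (_⇔_)

module Convergence {A : Set} (_⟶_ : A → A → Set) (Successful : A → Set) where
  _⟶*_ : A → A → Set
  _⟶*_ = Star _⟶_

  MayConv : A → Set
  MayConv x = ∃[ y ] (x ⟶* y × Successful y)

  MustConv : A → Set
  MustConv x = ∀ y → x ⟶* y → MayConv y

data SSub : Set where
  ✓  : SSub
  𝟘  : SSub
  !_ : SSub → SSub
  ¿_ : SSub → SSub      -- the input prefix ?U

-- A process is a parallel composition of subprocesses, i.e. a multiset;
-- represented as a list, taken up to permutation in the reduction rule.
SProc : Set
SProc = List SSub

data _⟶S_ : SProc → SProc → Set where
  comm : ∀ {P U₁ U₂ R} → P ↭ ((! U₁) ∷ (¿ U₂) ∷ R) → P ⟶S (U₁ ∷ U₂ ∷ R)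

SSuccessful : SProc → Set
SSuccessful P = Any (_≡ ✓) P

module SConv = Convergence _⟶S_ SSuccessful

data Action (k : ℕ) : Set where
  Pᵢ : Fin k → Action k
  Tᵢ : Fin k → Action k

data LSub (k : ℕ) : Set where
  𝟘  : LSub k
  ✓  : LSub k
  P_·_ : Fin k → LSub k → LSub k
  T_·_ : Fin k → LSub k → LSub k

LProc : ℕ → Set
LProc k = List (LSub k)

-- Store: true = full (■), false = empty (□).
Store : ℕ → Set
Store k = Vec Bool k

LState : ℕ → Set
LState k = LProc k × Store k

data _⟶L_ {k : ℕ} : LState k → LState k → Set where
  put  : ∀ {Q i U R C} → Q ↭ ((P i · U) ∷ R) → lookup C i ≡ false →
         (Q , C) ⟶L ((U ∷ R) , (C [ i ]≔ true))
  take : ∀ {Q i U R C} → Q ↭ ((T i · U) ∷ R) →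
         (Q , C) ⟶L ((U ∷ R) , (C [ i ]≔ false))

LSuccessful : ∀ {k} → LState k → Set
LSuccessful (Q , C) = Any (_≡ ✓) Q

module LConv {k : ℕ} = Convergence (_⟶L_ {k}) LSuccessful

LMayConv : ∀ {k} → Store k → LProc k → Set
LMayConv IS Q = LConv.MayConv (Q , IS)

LMustConv : ∀ {k} → Store k → LProc k → Set
LMustConv IS Q = LConv.MustConv (Q , IS)

prefix : ∀ {k} → List (Action k) → LSub k → LSub k
prefix []           U = U
prefix (Pᵢ i ∷ as)  U = P i · prefix as U
prefix (Tᵢ i ∷ as)  U = T i · prefix as U

record Translation (k : ℕ) : Set where
  constructor ⟨_,_⟩
  field
    τ! : List (Action k)
    τ? : List (Action k)

translateSub : ∀ {k} → Translation k → SSub → LSub k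
translateSub τ ✓      = ✓
translateSub τ 𝟘      = 𝟘
translateSub τ (! U)  = prefix (Translation.τ! τ) (translateSub τ U)
translateSub τ (¿ U)  = prefix (Translation.τ? τ) (translateSub τ U)

translate : ∀ {k} → Translation k → SProc → LProc k
translate τ Q = map (translateSub τ) Q

Correct : ∀ {k} → Store k → Translation k → Set
Correct IS τ = ∀ (Q : SProc) →
  (SConv.MayConv Q ⇔ LMayConv IS (translate τ Q)) ×
  (SConv.MustConv Q ⇔ LMustConv IS (translate τ Q))

C₁ C₂ C₃ : Fin 3
C₁ = zero
C₂ = suc zero
C₃ = suc (suc zero)

τ₂₉ : Translation 3
τ₂₉ = ⟨ Pᵢ C₁ ∷ Tᵢ C₃ ∷ Pᵢ C₂ ∷ Tᵢ C₁ ∷ [] , Pᵢ C₃ ∷ Tᵢ C₂ ∷ [] ⟩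

IS₂₉ : Store 3
IS₂₉ = false ∷ true ∷ true ∷ []

-- The handshake simulating  !U₁ | ?U₂  runs: the sender acquires C₁ and
-- releases C₃, the receiver acquires C₃ and releases C₂, the sender acquires
-- C₂ and releases C₁, restoring the initial store (□,■,■).  Apart from the
-- choice of a sender (the only enabled action in the initial store) and of a
-- receiver (once C₃ is free), every stage of a handshake admits exactly one
-- action, so every reachable state of a translated process is a stage of a
-- handshake of a source process reachable from the original one, the
-- communication being counted as soon as a receiver holds C₃.  The only state
-- that is stuck although its source is not is a sender waiting for a receiver
-- that does not exist; but then the source process cannot reduce at all, so
-- if it is may-convergent it is already successful.
module Submission where

open import Defs
open import Data.Nat using (ℕ)
open import Data.Fin using (zero; suc)
open import Data.Bool using (true; false)
open import Data.Vec using ([]; _∷_; lookup; _[_]≔_)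
open import Data.List using (_∷_; map; drop)
import Data.List.Relation.Unary.Any as Any
open Any using (Any; here; there)
import Data.List.Relation.Unary.Any.Properties as Anyₚ
open import Data.List.Membership.Propositional using (_∈_; _─_)
open import Data.List.Membership.Propositional.Properties using (∈-map⁻)
open import Data.List.Relation.Binary.Permutation.Propositional
open import Data.List.Relation.Binary.Permutation.Propositional.Properties
  using (∈-resp-↭; Any-resp-↭; drop-∷) renaming (map⁺ to ↭-map⁺)
open import Data.Product using (∃; Σ; _×_; _,_)
open import Data.Empty using (⊥; ⊥-elim)
open import Function using (_∘_)
open import Function.Bundles using (mk⇔)
open import Relation.Binary.PropositionalEquality using (_≡_; _≢_; refl; cong)
open import Relation.Binary.Construct.Closure.ReflexiveTransitive
  using (ε; _◅_; _◅◅_)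

open SConv using (MayConv; MustConv) renaming (_⟶*_ to _⟶S*_)
open LConv using () renaming (_⟶*_ to _⟶L*_)

module _ {A : Set} where

  remove-↭ : ∀ {x : A} {xs} (p : x ∈ xs) → xs ↭ x ∷ (xs ─ p)
  remove-↭ (here refl)            = refl
  remove-↭ {xs = y ∷ _} (there p) = trans (prep y (remove-↭ p)) (swap y _ refl)

  ↭-pick : ∀ {x : A} {xs ys} → x ∷ xs ↭ ys → Σ (x ∈ ys) λ p → xs ↭ ys ─ p
  ↭-pick σ = p , drop-∷ (trans σ (remove-↭ p))
    where p = ∈-resp-↭ σ (here refl)

module _ {A B : Set} (f : A → B) where

  ∈-map-─ : ∀ {y xs} (p : y ∈ map f xs) →
            ∃ λ x → Σ (x ∈ xs) λ q → y ≡ f x × map f xs ─ p ↭ map f (xs ─ q)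
  ∈-map-─ p with x , q , refl ← ∈-map⁻ f p =
    x , q , refl , drop-∷ (trans (↭-sym (remove-↭ p)) (↭-map⁺ f (remove-↭ q)))

variable
  R R' : SProc
  Q Q' : LProc 3
  U U₁ U₂ : SSub
  C C' : Store 3
  s s' : LState 3

_↠_ : SProc → SProc → Set
R ↠ R' = ∃ λ Q → R ⟶S* Q × Q ↭ R'

⟶S*-resp-↭ : R ↭ R' → ∀ {R''} → R' ⟶S* R'' → ∃ λ Q → R ⟶S* Q × Q ↭ R''
⟶S*-resp-↭ σ ε              = _ , ε , σ
⟶S*-resp-↭ σ (comm ρ ◅ st) = _ , comm (trans σ ρ) ◅ st , refl

↭⇒↠ : R ↭ R' → R ↠ R'
↭⇒↠ σ = _ , ε , σ

↠-trans : ∀ {R''} → R ↠ R' → R' ↠ R'' → R ↠ R''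
↠-trans (_ , st , σ) (_ , st' , σ') with _ , st'' , σ'' ← ⟶S*-resp-↭ σ st' =
  _ , st ◅◅ st'' , trans σ'' σ'

mayConv-resp-↭ : R ↭ R' → MayConv R' → MayConv R
mayConv-resp-↭ σ (_ , st , sc) with _ , st' , σ' ← ⟶S*-resp-↭ σ st =
  _ , st' , Any-resp-↭ (↭-sym σ') sc

mustConv-↠ : MustConv R → R ↠ R' → MustConv R'
mustConv-↠ must (_ , st , σ) _ st' with _ , st'' , σ' ← ⟶S*-resp-↭ σ st' =
  mayConv-resp-↭ (↭-sym σ') (must _ (st ◅◅ st''))

lmayConv-resp-↭ : Q ↭ Q' → LMayConv C Q' → LMayConv C Q
lmayConv-resp-↭ σ (_ , ε , sc)               = _ , ε , Any-resp-↭ (↭-sym σ) sc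
lmayConv-resp-↭ σ (_ , put ρ lk ◅ st , sc) = _ , put (trans σ ρ) lk ◅ st , sc
lmayConv-resp-↭ σ (_ , take ρ ◅ st , sc)   = _ , take (trans σ ρ) ◅ st , sc

lmayConv-⟵* : (Q , C) ⟶L* (Q' , C') → LMayConv C' Q' → LMayConv C Q
lmayConv-⟵* st (_ , st' , sc) = _ , st ◅◅ st' , sc

tr : SSub → LSub 3
tr = translateSub τ₂₉

!-after ¿-after : ℕ → SSub → LSub 3
!-after n U = prefix (drop n (Translation.τ! τ₂₉)) (tr U)
¿-after n U = prefix (drop n (Translation.τ? τ₂₉)) (tr U)

T∉tr : ∀ {i X} → T i · X ∈ map tr R → ⊥
T∉tr p with ∈-map⁻ tr p
... | ✓   , _ , ()
... | 𝟘   , _ , ()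
... | ! _ , _ , ()
... | ¿ _ , _ , ()

P₂∉tr : ∀ {X} → P C₂ · X ∈ map tr R → ⊥
P₂∉tr p with ∈-map⁻ tr p
... | ✓   , _ , ()
... | 𝟘   , _ , ()
... | ! _ , _ , ()
... | ¿ _ , _ , ()

tr-✓⁻¹ : ∀ {u} → tr u ≡ ✓ → u ≡ ✓
tr-✓⁻¹ {u = ✓}   _ = refl
tr-✓⁻¹ {u = 𝟘}   ()
tr-✓⁻¹ {u = ! _} ()
tr-✓⁻¹ {u = ¿ _} ()

✓-preserved : SSuccessful R → Any (_≡ ✓) (map tr R)
✓-preserved = Anyₚ.map⁺ ∘ Any.map (cong tr)

✓-reflected : Any (_≡ ✓) (map tr R) → SSuccessful R
✓-reflected = Any.map tr-✓⁻¹ ∘ Anyₚ.map⁻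

-- The sender does P₁ T₃, the receiver P₃ T₂, and the sender P₂ T₁.
simulation : R ⟶S R' → (map tr R , IS₂₉) ⟶L* (map tr R' , IS₂₉)
simulation (comm ρ) =
  put (↭-map⁺ tr ρ) refl ◅ take refl ◅
  put (swap _ _ refl) refl ◅ take refl ◅
  put (swap _ _ refl) refl ◅ take refl ◅ ε

simulation* : R ⟶S* R' → (map tr R , IS₂₉) ⟶L* (map tr R' , IS₂₉)
simulation* ε          = ε
simulation* (st ◅ sts) = simulation st ◅◅ simulation* sts

■■■ ■■□ ■□■ : Store 3
■■■ = true ∷ true ∷ true ∷ []
■■□ = true ∷ true ∷ false ∷ []
■□■ = true ∷ false ∷ true ∷ []

■■■-full : ∀ i → lookup ■■■ i ≢ false
■■■-full zero             ()
■■■-full (suc zero)       ()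
■■■-full (suc (suc zero)) ()

-- The index is the source process that the target state stands for.
data Phase : SProc → LState 3 → Set where
  idle         : Q ↭ map tr R → Phase R (Q , IS₂₉)
  locked       : Q ↭ !-after 1 U ∷ map tr R → Phase (! U ∷ R) (Q , ■■■)
  offered      : Q ↭ !-after 2 U ∷ map tr R → Phase (! U ∷ R) (Q , ■■□)
  received     : Q ↭ !-after 2 U₁ ∷ ¿-after 1 U₂ ∷ map tr R →
                 Phase (U₁ ∷ U₂ ∷ R) (Q , ■■■)
  acknowledged : Q ↭ !-after 2 U₁ ∷ map tr (U₂ ∷ R) →
                 Phase (U₁ ∷ U₂ ∷ R) (Q , ■□■)
  releasing    : Q ↭ !-after 3 U₁ ∷ map tr (U₂ ∷ R) →
                 Phase (U₁ ∷ U₂ ∷ R) (Q , ■■■)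

sender-locks : ∀ {i X} (p : P i · X ∈ map tr R) → Q ↭ map tr R ─ p →
               lookup IS₂₉ i ≡ false →
               ∃ λ R' → R ↠ R' × Phase R' (X ∷ Q , IS₂₉ [ i ]≔ true)
sender-locks p τ lk with ∈-map-─ tr p
sender-locks p τ lk | ! _ , q , refl , π =
  _ , ↭⇒↠ (remove-↭ q) , locked (prep _ (trans τ π))
sender-locks p τ () | ¿ _ , _ , refl , _
sender-locks p τ lk | ✓   , _ , () , _
sender-locks p τ lk | 𝟘   , _ , () , _

receiver-locks : ∀ {i X} (p : P i · X ∈ map tr R) →
                 Q ↭ !-after 2 U ∷ (map tr R ─ p) → lookup ■■□ i ≡ false →
                 ∃ λ R' → (! U ∷ R) ↠ R' × Phase R' (X ∷ Q , ■■□ [ i ]≔ true)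
receiver-locks p τ lk with ∈-map-─ tr p
receiver-locks p τ lk | ¿ _ , q , refl , π =
  _ , (_ , comm (prep _ (remove-↭ q)) ◅ ε , refl) ,
  received (trans (prep _ (trans τ (prep _ π))) (swap _ _ refl))
receiver-locks p τ () | ! _ , _ , refl , _
receiver-locks p τ lk | ✓   , _ , () , _
receiver-locks p τ lk | 𝟘   , _ , () , _

step : Phase R s → s ⟶L s' → ∃ λ R' → R ↠ R' × Phase R' s'
step (idle σ) (put ρ lk) with p , τ ← ↭-pick (trans (↭-sym ρ) σ) =
  sender-locks p τ lk
step (idle σ) (take ρ) with p , _ ← ↭-pick (trans (↭-sym ρ) σ) = ⊥-elim (T∉tr p)
step (locked _) (put {i = i} _ lk) = ⊥-elim (■■■-full i lk)
step (locked σ) (take ρ) with ↭-pick (trans (↭-sym ρ) σ)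
... | here refl , τ = _ , ↭⇒↠ refl , offered (prep _ τ)
... | there p   , _ = ⊥-elim (T∉tr p)
step (offered σ) (put ρ lk) with ↭-pick (trans (↭-sym ρ) σ)
step (offered σ) (put ρ ()) | here refl , _
step (offered σ) (put ρ lk) | there p   , τ = receiver-locks p τ lk
step (offered σ) (take ρ) with ↭-pick (trans (↭-sym ρ) σ)
... | here () , _
... | there p , _ = ⊥-elim (T∉tr p)
step (received _) (put {i = i} _ lk) = ⊥-elim (■■■-full i lk)
step (received σ) (take ρ) with ↭-pick (trans (↭-sym ρ) σ)
... | here () , _
... | there (here refl) , τ =
  _ , ↭⇒↠ refl , acknowledged (trans (prep _ τ) (swap _ _ refl))
... | there (there p) , _ = ⊥-elim (T∉tr p)
step (acknowledged _) (put {i = zero}             _ ())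
step (acknowledged _) (put {i = suc (suc zero)} _ ())
step (acknowledged {U₂ = U₂} {R = R} σ) (put {i = suc zero} ρ _)
  with ↭-pick (trans (↭-sym ρ) σ)
... | here refl , τ = _ , ↭⇒↠ refl , releasing (prep _ τ)
... | there p   , _ = ⊥-elim (P₂∉tr {R = U₂ ∷ R} p)
step (acknowledged {U₂ = U₂} {R = R} σ) (take ρ) with ↭-pick (trans (↭-sym ρ) σ)
... | here () , _
... | there p , _ = ⊥-elim (T∉tr {R = U₂ ∷ R} p)
step (releasing _) (put {i = i} _ lk) = ⊥-elim (■■■-full i lk)
step (releasing {U₂ = U₂} {R = R} σ) (take ρ) with ↭-pick (trans (↭-sym ρ) σ)
... | here refl , τ = _ , ↭⇒↠ refl , idle (prep _ τ)
... | there p   , _ = ⊥-elim (T∉tr {R = U₂ ∷ R} p)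

step* : Phase R s → s ⟶L* s' → ∃ λ R' → R ↠ R' × Phase R' s'
step* φ ε           = _ , ↭⇒↠ refl , φ
step* φ (st ◅ sts) =
  let _ , r₁ , φ₁ = step φ st
      _ , r₂ , φ₂ = step* φ₁ sts
  in  _ , ↠-trans r₁ r₂ , φ₂

phase-success : Phase R (Q , C) → LSuccessful (Q , C) → SSuccessful R
phase-success (idle σ) a = ✓-reflected (Any-resp-↭ σ a)
phase-success (locked σ) a with Any-resp-↭ σ a
... | here ()
... | there b = there (✓-reflected b)
phase-success (offered σ) a with Any-resp-↭ σ a
... | here ()
... | there b = there (✓-reflected b)
phase-success (received σ) a with Any-resp-↭ σ a
... | here ()
... | there (here ())
... | there (there b) = there (there (✓-reflected b))
phase-success (acknowledged σ) a with Any-resp-↭ σ a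
... | here ()
... | there b = there (✓-reflected b)
phase-success (releasing σ) a with Any-resp-↭ σ a
... | here ()
... | there b = there (✓-reflected b)

may-idle : Q ↭ map tr R → MayConv R → LMayConv IS₂₉ Q
may-idle σ (_ , st , sc) = lmayConv-resp-↭ σ (_ , simulation* st , ✓-preserved sc)

may-received : Q ↭ !-after 2 U₁ ∷ ¿-after 1 U₂ ∷ map tr R →
               MayConv (U₁ ∷ U₂ ∷ R) → LMayConv ■■■ Q
may-received σ m =
  lmayConv-⟵*
    (take (trans σ (swap _ _ refl)) ◅ put (swap _ _ refl) refl ◅ take refl ◅ ε)
    (may-idle refl m)

-- A sender that has released C₃ is stuck until some receiver takes it; if
-- the source cannot communicate, its may-convergence is immediate success.
may-offered : Q ↭ !-after 2 U ∷ map tr R → MustConv (! U ∷ R) → LMayConv ■■□ Q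
may-offered {Q = Q} {U = U} {R = R} σ must with must _ ε
... | _ , ε , here ()
... | _ , ε , there a = _ , ε , Any-resp-↭ (↭-sym σ) (there (✓-preserved a))
... | _ , comm {U₂ = V} ρ ◅ _ , _ with ∈-resp-↭ (↭-sym ρ) (there (here refl))
... | there r =
  lmayConv-⟵* (put receiver-first refl ◅ ε)
              (may-received (swap _ _ refl) (mustConv-↠ must communicated _ ε))
  where
  receiver-first : Q ↭ P C₃ · ¿-after 1 V ∷ !-after 2 U ∷ map tr (R ─ r)
  receiver-first =
    trans σ (trans (prep _ (↭-map⁺ tr (remove-↭ r))) (swap _ _ refl))
  communicated : (! U ∷ R) ↠ (U ∷ V ∷ (R ─ r))
  communicated = _ , comm (prep _ (remove-↭ r)) ◅ ε , refl

phase-may : Phase R (Q , C) → MustConv R → LMayConv C Q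
phase-may (idle σ)         must = may-idle σ (must _ ε)
phase-may (locked σ)       must = lmayConv-⟵* (take σ ◅ ε) (may-offered refl must)
phase-may (offered σ)      must = may-offered σ must
phase-may (received σ)     must = may-received σ (must _ ε)
phase-may (acknowledged σ) must =
  lmayConv-⟵* (put σ refl ◅ take refl ◅ ε) (may-idle refl (must _ ε))
phase-may (releasing σ)    must = lmayConv-⟵* (take σ ◅ ε) (may-idle refl (must _ ε))

may-preserved : MayConv R → LMayConv IS₂₉ (map tr R)
may-preserved = may-idle refl

may-reflected : LMayConv IS₂₉ (map tr R) → MayConv R
may-reflected (_ , st , sc) with _ , (_ , st' , σ) , φ ← step* (idle refl) st =
  _ , st' , Any-resp-↭ (↭-sym σ) (phase-success φ sc)

must-preserved : MustConv R → LMustConv IS₂₉ (map tr R)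
must-preserved must _ st with _ , r , φ ← step* (idle refl) st =
  phase-may φ (mustConv-↠ must r)

must-reflected : LMustConv IS₂₉ (map tr R) → MustConv R
must-reflected must _ st = may-reflected (must _ (simulation* st))

theorem2p9 : Correct IS₂₉ τ₂₉
theorem2p9 _ = mk⇔ may-preserved may-reflected , mk⇔ must-preserved must-reflected
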